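{- Let $G$ be a finite simple connected graph with weight function $\omega:E(G)\to\{1,2,3,\dots\}$ and goal vertex $x$. If $x$ is not reachable from a pebble distribution $p$ of size $n$, then there is a pebble distribution of size $n$ that is squished on each unweighted open ear of $G$ and from which $x$ is still not reachable.
   Context: A pebble distribution is a function $p:V(G)\to\mathbb{Z}_{\ge0}$, of size $\sum_v p(v)$. For an edge $yz$, the pebbling move $(y\to z)$ removes $\omega(yz)$ pebbles from $y$ and adds one at $z$; a sequence of moves is executable from $p$ if no vertex ever has a negative number of pebbles; $x$ is reachable from $p$ if some executable sequence puts at least one pebble on $x$. A thread of $G$ is a path all of whose vertices have degree $2$ in $G$. Let $v_1,\dots,v_n$ be the consecutive vertices of a maximal thread not containing $x$; there are unique vertices $v_0,v_{n+1}$ outside the thread adjacent to $v_1$ and $v_n$ respectively. The subgraph $E$ induced by $v_0,\dots,v_{n+1}$ is an ear (with respect to $x$), with inner vertices $v_1,\dots,v_n$. It is closed if $v_0=v_{n+1}$, a cut ear if its inner vertices are cut vertices of $G$, and an open ear if it is neither closed nor a cut ear. An ear is unweighted if all its edges $v_iv_{i+1}$ have weight $2$. A pebble distribution is squished on a path $P$ if all the pebbles on vertices of $P$ lie on a single vertex of $P$ or on two adjacent vertices of $P$; being squished on an ear means being squished on the path $v_0,v_1,\dots,v_{n+1}$. -}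

module Defs where

open import Data.Nat using (ℕ; zero; suc; _+_; _∸_; _≤_)
open import Data.Bool using (Bool; true; false; if_then_else_)
open import Data.Fin using (Fin; _≟_)
open import Data.List using (List; map; allFin)
open import Data.Nat.ListAction using (sum)
open import Data.Product using (Σ; ∃; _×_; _,_)
open import Data.Sum using (_⊎_)
open import Relation.Nullary using (¬_; does)
open import Relation.Binary.PropositionalEquality using (_≡_; _≢_)

record WGraph (k : ℕ) : Set where
  field
    adj        : Fin k → Fin k → Bool
    adj-sym    : ∀ u v → adj u v ≡ adj v u
    adj-irrefl : ∀ v → adj v v ≡ false
    -- weight ω(uv); only meaningful on edges
    ω          : Fin k → Fin k → ℕ
    ω-sym      : ∀ u v → ω u v ≡ ω v u
    ω-pos      : ∀ u v → adj u v ≡ true → 1 ≤ ω u v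

open WGraph public

module _ {k : ℕ} (G : WGraph k) where

  deg : Fin k → ℕ
  deg u = sum (map (λ v → if adj G u v then 1 else 0) (allFin k))

  data WalkIn (ok : Fin k → Set) : Fin k → Fin k → Set where
    here  : ∀ {u} → ok u → WalkIn ok u u
    there : ∀ {u v w} → ok u → adj G u v ≡ true → WalkIn ok v w → WalkIn ok u w

  Connected : Set
  Connected = ∀ u w → WalkIn (λ _ → Fin k) u w

  IsCutVertex : Fin k → Set
  IsCutVertex c = Σ (Fin k) λ u → Σ (Fin k) λ w →
    u ≢ c × w ≢ c × ¬ WalkIn (λ v → v ≢ c) u w

  Distribution : Set
  Distribution = Fin k → ℕ

  size : Distribution → ℕ
  size p = sum (map p (allFin k))

  move : Distribution → Fin k → Fin k → Distribution
  move p y z v =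
    (if does (v ≟ y) then p v ∸ ω G y z else p v) + (if does (v ≟ z) then 1 else 0)

  data Executes : Distribution → Distribution → Set where
    done : ∀ {p} → Executes p p
    step : ∀ {p q} y z → adj G y z ≡ true → ω G y z ≤ p y →
           Executes (move p y z) q → Executes p q

  Reachable : Fin k → Distribution → Set
  Reachable x p = Σ Distribution λ q → Executes p q × 1 ≤ q x

  -- An ear is given by n ≥ 1 and the sequence v 0, v 1, …, v (n+1)
  -- (values of v at indices > n+1 are irrelevant); the inner vertices
  -- v 1 … v n form a maximal thread not containing x.

  record IsEar (x : Fin k) (n : ℕ) (v : ℕ → Fin k) : Set where
    field
      nonempty   : 1 ≤ n
      inner-inj  : ∀ i j → 1 ≤ i → i ≤ n → 1 ≤ j → j ≤ n → v i ≡ v j → i ≡ j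
      consec-adj : ∀ i → i ≤ n → adj G (v i) (v (suc i)) ≡ true
      -- all inner vertices have degree 2 and are not x; their two
      -- neighbours are exactly v (i-1) and v (i+1)
      inner-deg  : ∀ i → 1 ≤ i → i ≤ n → deg (v i) ≡ 2
      inner-notx : ∀ i → 1 ≤ i → i ≤ n → v i ≢ x
      inner-nbrs : ∀ i → 1 ≤ i → i ≤ n → v (i ∸ 1) ≢ v (suc i)
      ends-out   : ∀ i → 1 ≤ i → i ≤ n → v 0 ≢ v i × v (suc n) ≢ v i
      max-left   : deg (v 0) ≢ 2 ⊎ v 0 ≡ x
      max-right  : deg (v (suc n)) ≢ 2 ⊎ v (suc n) ≡ x

  IsClosedEar : ℕ → (ℕ → Fin k) → Set
  IsClosedEar n v = v 0 ≡ v (suc n)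

  IsCutEar : ℕ → (ℕ → Fin k) → Set
  IsCutEar n v = ∀ i → 1 ≤ i → i ≤ n → IsCutVertex (v i)

  IsOpenEar : (x : Fin k) → ℕ → (ℕ → Fin k) → Set
  IsOpenEar x n v = IsEar x n v × ¬ IsClosedEar n v × ¬ IsCutEar n v

  Unweighted : ℕ → (ℕ → Fin k) → Set
  Unweighted n v = ∀ i → i ≤ n → ω G (v i) (v (suc i)) ≡ 2

  Squished : Distribution → ℕ → (ℕ → Fin k) → Set
  Squished p n v = Σ ℕ λ i → i ≤ n ×
    (∀ j → j ≤ suc n → j ≢ i → j ≢ suc i → p (v j) ≡ 0)

-- Call a path w 0, …, w N (N ≥ 2) through an unweighted thread avoiding x squishable for q if
-- both of its ends carry a pebble, and squish q along it by moving one pebble from each end one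
-- step inwards. This keeps x unreachable: the two moved pebbles behave like tokens that can only
-- be pushed along the thread, two pebbles at a time, so every pebbling sequence from the squished
-- distribution is mirrored by one from q. It also strictly decreases Σ q(v) φ(v), where
-- φ(v) = (B − d(v, x))² for a bound B on all distances to x; φ is strictly convex along every
-- thread avoiding x, since each inner vertex has a neighbour closer to x. So squishing terminates,
-- and a distribution without squishable paths is squished on every unweighted ear that is not
-- closed.

module Submission where

open import Defs
open import Data.Bool using (true; if_then_else_)
open import Data.Bool.Properties using () renaming (_≟_ to _≟ᵇ_)
open import Data.Empty using (⊥; ⊥-elim)
open import Data.Fin using (Fin; zero; suc; _≟_; toℕ)
open import Data.Fin.Properties using (any?; all?; injective⇒≤; toℕ-injective; toℕ<n)
open import Data.List using (map; allFin; tabulate)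
open import Data.List.Properties using (map-tabulate)
open import Data.Nat using (ℕ; zero; suc; _+_; _*_; _∸_; _≤_; _<_; z≤n; s≤s; s≤s⁻¹)
open import Data.Nat.Induction using (<-wellFounded)
import Data.Nat.ListAction as List
open import Data.Nat.Properties hiding (_≟_)
open import Data.Nat.Properties using () renaming (_≟_ to _≟ℕ_)
open import Algebra.Properties.CommutativeSemigroup +-commutativeSemigroup using (xy∙z≈xz∙y)
open import Algebra.Properties.Semiring.Sum +-*-semiring
  using (sum-cong-≗; ∑-distrib-+; sum-replicate-zero) renaming (sum to ∑)
open import Data.Nat.Tactic.RingSolver using (solve-∀)
open import Data.Product using (Σ; ∃; _×_; _,_; proj₁; proj₂)
open import Data.Sum using (_⊎_; inj₁; inj₂)
open import Function using (id; _∘_)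
open import Induction.WellFounded using (Acc; acc)
open import Relation.Binary.Definitions using (tri<; tri≈; tri>)
open import Relation.Binary.PropositionalEquality
open import Relation.Nullary using (¬_; Dec; yes; no; does)
open import Relation.Nullary.Decidable using (map′; ¬?; _×-dec_; _⊎-dec_; _→-dec_)

least : ∀ {P : ℕ → Set} → (∀ n → Dec (P n)) → ∀ {n} → P n →
        ∃ λ i → P i × (∀ {j} → j < i → ¬ P j)
least P? {n} pn with P? 0
... | yes p0 = 0 , p0 , λ ()
least P? {zero}  pn | no ¬p0 = ⊥-elim (¬p0 pn)
least P? {suc n} pn | no ¬p0 with least (λ i → P? (suc i)) pn
... | i , pi , below = suc i , pi , λ { {zero} _ → ¬p0 ; {suc j} j<i → below (s≤s⁻¹ j<i) }

minimal-≤ : ∀ {P : ℕ → Set} {i j} → (∀ {j} → j < i → ¬ P j) → P j → i ≤ j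
minimal-≤ below pj = ≮⇒≥ (λ j<i → below j<i pj)

square-convex : ∀ {r i j} → suc r ≤ i → r ≤ suc j → r * r + r * r + 1 ≤ i * i + j * j
square-convex {zero} {i} {j} 1≤i _ = ≤-trans (*-mono-≤ 1≤i 1≤i) (m≤m+n (i * i) (j * j))
square-convex {suc m} {i} {j} 2+m≤i m≤j = begin
  suc m * suc m + suc m * suc m + 1     ≤⟨ m≤m+n _ 1 ⟩
  suc m * suc m + suc m * suc m + 1 + 1 ≡⟨ identity m ⟩
  suc (suc m) * suc (suc m) + m * m     ≤⟨ +-mono-≤ (*-mono-≤ 2+m≤i 2+m≤i) (*-mono-≤ (s≤s⁻¹ m≤j) (s≤s⁻¹ m≤j)) ⟩
  i * i + j * j                         ∎
  where
  open ≤-Reasoning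
  identity : ∀ m → suc m * suc m + suc m * suc m + 1 + 1 ≡ suc (suc m) * suc (suc m) + m * m
  identity = solve-∀

convex-telescope : ∀ (F : ℕ → ℕ) g →
  (∀ {i} → i < 2 + g → 1 ≤ i → F i + F i + 1 ≤ F (i ∸ 1) + F (suc i)) →
  F 1 + F (suc g) + 1 ≤ F 0 + F (2 + g)
convex-telescope F zero convex = convex (s≤s (s≤s z≤n)) (s≤s z≤n)
convex-telescope F (suc g) convex = +-cancelʳ-≤ (F (suc g) + F (2 + g)) _ _ (begin
  F 1 + F (2 + g) + 1 + (F (suc g) + F (2 + g))         ≤⟨ m≤m+n _ 1 ⟩
  F 1 + F (2 + g) + 1 + (F (suc g) + F (2 + g)) + 1     ≡⟨ regroup (F 1) (F (2 + g)) (F (suc g)) ⟩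
  (F 1 + F (suc g) + 1) + (F (2 + g) + F (2 + g) + 1)   ≤⟨ +-mono-≤ outer inner ⟩
  (F 0 + F (2 + g)) + (F (suc g) + F (3 + g))           ≡⟨ swap (F 0) (F (2 + g)) (F (suc g)) (F (3 + g)) ⟩
  F 0 + F (3 + g) + (F (suc g) + F (2 + g))             ∎)
  where
  open ≤-Reasoning
  outer = convex-telescope F g (λ i<2+g → convex (m≤n⇒m≤1+n i<2+g))
  inner = convex (s≤s (s≤s (s≤s ≤-refl))) (s≤s z≤n)
  regroup : ∀ a b c → a + b + 1 + (c + b) + 1 ≡ a + c + 1 + (b + b + 1)
  regroup = solve-∀
  swap : ∀ a b c d → a + b + (c + d) ≡ a + d + (c + b)
  swap = solve-∀

∸≤suc∸suc : ∀ m n → m ∸ n ≤ suc (m ∸ suc n)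
∸≤suc∸suc zero    zero    = z≤n
∸≤suc∸suc zero    (suc n) = z≤n
∸≤suc∸suc (suc m) zero    = ≤-refl
∸≤suc∸suc (suc m) (suc n) = ∸≤suc∸suc m n

<-from-balance : ∀ {X Y a b c d} → X + a + b ≡ Y + c + d → c + d + 1 ≤ a + b → X < Y
<-from-balance {X} {Y} {a} {b} {c} {d} balance c+d<a+b = +-cancelʳ-≤ (a + b) _ _ (begin
  suc X + (a + b)   ≡⟨ cong suc (+-assoc X a b) ⟨
  suc (X + a + b)   ≡⟨ cong suc balance ⟩
  suc (Y + c + d)   ≡⟨ regroup Y c d ⟩
  Y + (c + d + 1)   ≤⟨ +-monoʳ-≤ Y c+d<a+b ⟩
  Y + (a + b)       ∎)
  where
  open ≤-Reasoning
  regroup : ∀ y c d → suc (y + c + d) ≡ y + (c + d + 1)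
  regroup = solve-∀

decide-∃-sequence : ∀ {k} N {P : (ℕ → Fin k) → Set} →
  (∀ {u v} → (∀ {i} → i ≤ N → u i ≡ v i) → P u → P v) → (∀ w → Dec (P w)) → Dec (∃ P)
decide-∃-sequence zero {P} resp P? with any? (λ a → P? (λ _ → a))
... | yes (a , pa) = yes (_ , pa)
... | no ¬pa       = no λ (w , pw) → ¬pa (w 0 , resp (λ { {zero} _ → refl }) pw)
decide-∃-sequence {k} (suc N) {P} resp P?
  with any? (λ a → decide-∃-sequence N {λ w → P (a ◃ w)} (resp ∘ ◃-agree) (λ w → P? (a ◃ w)))
  where
  _◃_ : Fin k → (ℕ → Fin k) → ℕ → Fin k
  (a ◃ w) zero    = a
  (a ◃ w) (suc i) = w i
  ◃-agree : ∀ {a u v} → (∀ {i} → i ≤ N → u i ≡ v i) → ∀ {i} → i ≤ suc N → (a ◃ u) i ≡ (a ◃ v) i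
  ◃-agree agree {zero}  _     = refl
  ◃-agree agree {suc i} i≤1+N = agree (s≤s⁻¹ i≤1+N)
... | yes (a , w , pw) = yes (_ , pw)
... | no ¬p            =
  no λ (w , pw) → ¬p (w 0 , (λ i → w (suc i)) , resp (λ { {zero} _ → refl ; {suc i} _ → refl }) pw)

squished-indices : ∀ {P : ℕ → Set} → (∀ j → Dec (P j)) → ∀ n →
  (∀ {i N} → 2 ≤ N → N + i ≤ suc n → P i → P (N + i) → ⊥) →
  ∃ λ i → i ≤ n × (∀ j → j ≤ suc n → j ≢ i → j ≢ suc i → ¬ P j)
squished-indices {P} P? n gap with anyUpTo? P? (suc (suc n))
... | no none = 0 , z≤n , λ j j≤1+n _ _ pj → none (j , s≤s j≤1+n , pj)
... | yes (j , j≤1+n , pj) with least P? pj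
...   | i , pi , below with i ≤? n
...     | yes i≤n = i , i≤n , outside
  where
  outside : ∀ j → j ≤ suc n → j ≢ i → j ≢ suc i → ¬ P j
  outside j j≤1+n j≢i j≢1+i pj with <-cmp j i
  ... | tri< j<i _ _ = below j<i pj
  ... | tri≈ _ j≡i _ = j≢i j≡i
  ... | tri> _ _ i<j =
    gap (m+n≤o⇒m≤o∸n 2 2+i≤j) (subst (_≤ suc n) (sym j∸i+i≡j) j≤1+n) pi (subst P (sym j∸i+i≡j) pj)
    where
    2+i≤j = ≤∧≢⇒< i<j (λ 1+i≡j → j≢1+i (sym 1+i≡j))
    j∸i+i≡j = m∸n+n≡m (<⇒≤ i<j)
...     | no i≰n = n , ≤-refl , λ j j≤1+n _ j≢1+n → below (≤-<-trans (s≤s⁻¹ (≤∧≢⇒< j≤1+n j≢1+n)) (≰⇒> i≰n))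

-- written as in Defs.move, whose last summand is then δ z v
δ : ∀ {k} → Fin k → Fin k → ℕ
δ u v = if does (v ≟ u) then 1 else 0

δ-≢ : ∀ {k} {u v : Fin k} → v ≢ u → δ u v ≡ 0
δ-≢ {u = u} {v} v≢u with v ≟ u
... | yes v≡u = ⊥-elim (v≢u v≡u)
... | no _    = refl

δ-≤ : ∀ {k} {f : Fin k → ℕ} {u} → 1 ≤ f u → ∀ v → δ u v ≤ f v
δ-≤ {u = u} 1≤fu v with v ≟ u
... | yes refl = 1≤fu
... | no _     = z≤n

∑-allFin : ∀ {k} (f : Fin k → ℕ) → List.sum (map f (allFin k)) ≡ ∑ f
∑-allFin f = trans (cong List.sum (map-tabulate id f)) (sum-tabulate f)
  where
  sum-tabulate : ∀ {n} (f : Fin n → ℕ) → List.sum (tabulate f) ≡ ∑ f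
  sum-tabulate {zero}  f = refl
  sum-tabulate {suc n} f = cong (f zero +_) (sum-tabulate (λ v → f (suc v)))

∑-mono-≤ : ∀ {k} {f g : Fin k → ℕ} → (∀ v → f v ≤ g v) → ∑ f ≤ ∑ g
∑-mono-≤ {zero}  _   = z≤n
∑-mono-≤ {suc k} f≤g = +-mono-≤ (f≤g zero) (∑-mono-≤ (λ v → f≤g (suc v)))

_·_ : ∀ {k} → (Fin k → ℕ) → (Fin k → ℕ) → ℕ
f · h = ∑ (λ v → f v * h v)

δ-· : ∀ {k} (u : Fin k) h → δ u · h ≡ h u
δ-· {suc k} zero    h =
  trans (cong (h zero + 0 +_) (sum-replicate-zero k)) (trans (+-identityʳ _) (+-identityʳ _))
δ-· {suc k} (suc u) h = δ-· u (λ v → h (suc v))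

·-distrib-+ : ∀ {k} (f g h : Fin k → ℕ) → (λ v → f v + g v) · h ≡ f · h + g · h
·-distrib-+ f g h =
  trans (sum-cong-≗ (λ v → *-distribʳ-+ (h v) (f v) (g v))) (∑-distrib-+ (λ v → f v * h v) (λ v → g v * h v))

∑≡·1 : ∀ {k} (f : Fin k → ℕ) → ∑ f ≡ f · (λ _ → 1)
∑≡·1 f = sum-cong-≗ (λ v → sym (*-identityʳ (f v)))

≤∑ : ∀ {k} (f : Fin k → ℕ) u → f u ≤ ∑ f
≤∑ f u = subst (_≤ ∑ f) (δ-· u f) (∑-mono-≤ δ*≤)
  where
  δ*≤ : ∀ v → δ u v * f v ≤ f v
  δ*≤ v with v ≟ u
  ... | yes _ = ≤-reflexive (*-identityˡ (f v))
  ... | no _  = z≤n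

∑-δ : ∀ {k} (u : Fin k) → ∑ (δ u) ≡ 1
∑-δ u = trans (∑≡·1 (δ u)) (δ-· u (λ _ → 1))

relocate : ∀ {k} → (Fin k → ℕ) → Fin k → Fin k → Fin k → ℕ
relocate q u v t = q t ∸ δ u t + δ v t

relocate-+δ : ∀ {k} {q : Fin k → ℕ} {u} v → 1 ≤ q u → ∀ t → relocate q u v t + δ u t ≡ q t + δ v t
relocate-+δ {q = q} {u} v 1≤qu t = begin
  q t ∸ δ u t + δ v t + δ u t ≡⟨ xy∙z≈xz∙y (q t ∸ δ u t) (δ v t) (δ u t) ⟩
  q t ∸ δ u t + δ u t + δ v t ≡⟨ cong (_+ δ v t) (m∸n+n≡m (δ-≤ 1≤qu t)) ⟩
  q t + δ v t                 ∎
  where open ≡-Reasoning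

·-relocate : ∀ {k} {q : Fin k → ℕ} {u} v h → 1 ≤ q u → relocate q u v · h + h u ≡ q · h + h v
·-relocate {q = q} {u} v h 1≤qu = begin
  relocate q u v · h + h u                    ≡⟨ cong (relocate q u v · h +_) (δ-· u h) ⟨
  relocate q u v · h + δ u · h                ≡⟨ ·-distrib-+ (relocate q u v) (δ u) h ⟨
  (λ t → relocate q u v t + δ u t) · h       ≡⟨ sum-cong-≗ (λ t → cong (_* h t) (relocate-+δ v 1≤qu t)) ⟩
  (λ t → q t + δ v t) · h                    ≡⟨ ·-distrib-+ q (δ v) h ⟩
  q · h + δ v · h                             ≡⟨ cong (q · h +_) (δ-· v h) ⟩
  q · h + h v                                 ∎
  where open ≡-Reasoning

∑-relocate : ∀ {k} {q : Fin k → ℕ} {u} v → 1 ≤ q u → ∑ (relocate q u v) ≡ ∑ q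
∑-relocate {q = q} {u} v 1≤qu = +-cancelʳ-≡ 1 (∑ (relocate q u v)) (∑ q) (begin
  ∑ (relocate q u v) + 1          ≡⟨ cong (_+ 1) (∑≡·1 (relocate q u v)) ⟩
  relocate q u v · (λ _ → 1) + 1  ≡⟨ ·-relocate v (λ _ → 1) 1≤qu ⟩
  q · (λ _ → 1) + 1               ≡⟨ cong (_+ 1) (∑≡·1 q) ⟨
  ∑ q + 1                         ∎)
  where open ≡-Reasoning

module _ {k : ℕ} (G : WGraph k) where

  Adjacent : Fin k → Fin k → Set
  Adjacent u v = adj G u v ≡ true

  adjacent-sym : ∀ {u v} → Adjacent u v → Adjacent v u
  adjacent-sym {u} {v} uv = trans (adj-sym G v u) uv

  OnlyNeighbours : Fin k → Fin k → Fin k → Set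
  OnlyNeighbours u p r = ∀ z → Adjacent u z → z ≡ p ⊎ z ≡ r

  deg≡2⇒only-neighbours : ∀ {u p r} → deg G u ≡ 2 → Adjacent u p → Adjacent u r → p ≢ r →
                          OnlyNeighbours u p r
  deg≡2⇒only-neighbours {u} {p} {r} deg≡2 up ur p≢r z uz with z ≟ p | z ≟ r
  ... | yes z≡p | _       = inj₁ z≡p
  ... | no _    | yes z≡r = inj₂ z≡r
  ... | no z≢p  | no z≢r  = ⊥-elim (<⇒≱ (s≤s (s≤s (s≤s z≤n))) (subst (3 ≤_) deg≡2 three≤deg))
    where
    incidence : Fin k → ℕ
    incidence v = if adj G u v then 1 else 0

    three-points : ∀ v → δ p v + δ r v + δ z v ≤ incidence v
    three-points v with v ≟ p | v ≟ r | v ≟ z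
    ... | yes refl | yes refl | _        = ⊥-elim (p≢r refl)
    ... | yes refl | _        | yes refl = ⊥-elim (z≢p refl)
    ... | _        | yes refl | yes refl = ⊥-elim (z≢r refl)
    ... | yes refl | no _     | no _     = ≤-reflexive (cong (λ b → if b then 1 else 0) (sym up))
    ... | no _     | yes refl | no _     = ≤-reflexive (cong (λ b → if b then 1 else 0) (sym ur))
    ... | no _     | no _     | yes refl = ≤-reflexive (cong (λ b → if b then 1 else 0) (sym uz))
    ... | no _     | no _     | no _     = z≤n

    three≤deg : 3 ≤ deg G u
    three≤deg = begin
      3                                   ≡⟨ cong₂ _+_ (cong₂ _+_ (∑-δ p) (∑-δ r)) (∑-δ z) ⟨
      ∑ (δ p) + ∑ (δ r) + ∑ (δ z)         ≡⟨ cong (_+ ∑ (δ z)) (∑-distrib-+ (δ p) (δ r)) ⟨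
      ∑ (λ v → δ p v + δ r v) + ∑ (δ z)   ≡⟨ ∑-distrib-+ (λ v → δ p v + δ r v) (δ z) ⟨
      ∑ (λ v → δ p v + δ r v + δ z v)     ≤⟨ ∑-mono-≤ three-points ⟩
      ∑ incidence                         ≡⟨ ∑-allFin incidence ⟨
      deg G u                             ∎
      where open ≤-Reasoning

  move-cost-2 : ∀ {s : Distribution G} {y z} → ω G y z ≡ 2 → 2 ≤ s y →
               ∀ v → move G s y z v + δ y v + δ y v ≡ s v + δ z v
  move-cost-2 {s} {y} {z} ω≡2 2≤sy v with v ≟ y
  ... | yes refl rewrite ω≡2 = pay-two (δ z v) 2≤sy
    where
    pay-two : ∀ {a} b → 2 ≤ a → a ∸ 2 + b + 1 + 1 ≡ a + b
    pay-two {suc (suc a)} b (s≤s (s≤s z≤n)) = lemma a b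
      where
      lemma : ∀ a b → a + b + 1 + 1 ≡ suc (suc a) + b
      lemma = solve-∀
  ... | no _ = trans (+-identityʳ _) (+-identityʳ _)

  move-mono : ∀ {s s′ : Distribution G} {A B : Fin k → ℕ} {y z} →
              ω G y z ≤ s′ y → ω G y z ≤ s y → (∀ v → s′ v + A v ≤ s v + B v) →
              ∀ v → move G s′ y z v + A v ≤ move G s y z v + B v
  move-mono {s} {s′} {A} {B} {y} {z} ω≤s′y ω≤sy s′≤s v with v ≟ y
  ... | yes refl = begin
    s′ v ∸ ω G v z + δ z v + A v   ≡⟨ xy∙z≈xz∙y (s′ v ∸ ω G v z) (δ z v) (A v) ⟩
    s′ v ∸ ω G v z + A v + δ z v   ≡⟨ cong (_+ δ z v) (+-∸-comm (A v) ω≤s′y) ⟨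
    s′ v + A v ∸ ω G v z + δ z v   ≤⟨ +-monoˡ-≤ (δ z v) (∸-monoˡ-≤ (ω G v z) (s′≤s v)) ⟩
    s v + B v ∸ ω G v z + δ z v    ≡⟨ cong (_+ δ z v) (+-∸-comm (B v) ω≤sy) ⟩
    s v ∸ ω G v z + B v + δ z v    ≡⟨ xy∙z≈xz∙y (s v ∸ ω G v z) (B v) (δ z v) ⟩
    s v ∸ ω G v z + δ z v + B v    ∎
    where open ≤-Reasoning
  ... | no _ = begin
    s′ v + δ z v + A v   ≡⟨ xy∙z≈xz∙y (s′ v) (δ z v) (A v) ⟩
    s′ v + A v + δ z v   ≤⟨ +-monoˡ-≤ (δ z v) (s′≤s v) ⟩
    s v + B v + δ z v    ≡⟨ xy∙z≈xz∙y (s v) (B v) (δ z v) ⟩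
    s v + δ z v + B v    ∎
    where open ≤-Reasoning

  executes-trans : ∀ {p q r} → Executes G p q → Executes G q r → Executes G p r
  executes-trans done                 qr = qr
  executes-trans (step y z yz ω≤ pq) qr = step y z yz ω≤ (executes-trans pq qr)

-- t arises from s′ by a move of cost two from the token C onto Z; A and B (or E = A + B) are the
-- pebbles the tokens were taken from
token-core : ∀ t s′ s {E C D Z} → t + C + C ≡ s′ + Z → s′ + E ≤ s + (C + D) → t + E + C ≤ s + (Z + D)
token-core t s′ s {E} {C} {D} {Z} exact bound = +-cancelʳ-≤ C _ _ (begin
  t + E + C + C   ≡⟨ regroup t E C ⟩
  t + C + C + E   ≡⟨ cong (_+ E) exact ⟩
  s′ + Z + E      ≡⟨ xy∙z≈xz∙y s′ Z E ⟩
  s′ + E + Z      ≤⟨ +-monoˡ-≤ Z bound ⟩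
  s + (C + D) + Z ≡⟨ regroup′ s C D Z ⟩
  s + (Z + D) + C ∎)
  where
  open ≤-Reasoning
  regroup : ∀ t e c → t + e + c + c ≡ t + c + c + e
  regroup = solve-∀
  regroup′ : ∀ s c d z → s + (c + d) + z ≡ s + (z + d) + c
  regroup′ = solve-∀

token-advances : ∀ t s′ s {E C D Z} → t + C + C ≡ s′ + Z → s′ + E ≤ s + (C + D) → t + E ≤ s + (Z + D)
token-advances t s′ s {C = C} exact bound = ≤-trans (m≤m+n _ C) (token-core t s′ s exact bound)

token-absorbed : ∀ t s′ s {A B C D} → t + C + C ≡ s′ + A → s′ + (A + B) ≤ s + (C + D) →
                 t + (C + B) ≤ s + (D + D)
token-absorbed t s′ s {A} {B} {C} {D} exact bound = ≤-trans
  (+-cancelˡ-≤ A _ _ (begin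
    A + (t + (C + B))   ≡⟨ regroup A t C B ⟩
    t + (A + B) + C     ≤⟨ token-core t s′ s exact bound ⟩
    s + (A + D)         ≡⟨ regroup′ s A D ⟩
    A + (s + D)         ∎))
  (+-monoʳ-≤ s (m≤n+m D D))
  where
  open ≤-Reasoning
  regroup : ∀ a t c b → a + (t + (c + b)) ≡ t + (a + b) + c
  regroup = solve-∀
  regroup′ : ∀ s a d → s + (a + d) ≡ a + (s + d)
  regroup′ = solve-∀

tokens-absorbed : ∀ t s′ s {A B C} → t + C + C ≡ s′ + A → s′ + (A + B) ≤ s + (C + C) → t ≤ s
tokens-absorbed t s′ s {A} {B} {C} exact bound = ≤-trans (m≤m+n t B)
  (+-cancelˡ-≤ (A + C) _ _ (begin
    A + C + (t + B)     ≡⟨ regroup A C t B ⟩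
    t + (A + B) + C     ≤⟨ token-core t s′ s exact bound ⟩
    s + (A + C)         ≡⟨ +-comm s (A + C) ⟩
    A + C + s           ∎))
  where
  open ≤-Reasoning
  regroup : ∀ a c t b → a + c + (t + b) ≡ t + (a + b) + c
  regroup = solve-∀

≤-without-offset : ∀ {a b c e} → a + b ≤ c + e → e ≡ 0 → a ≤ c
≤-without-offset {a} {b} {c} a+b≤c+e refl = ≤-trans (m≤m+n a b) (subst (a + b ≤_) (+-identityʳ c) a+b≤c+e)

module _ {k : ℕ} (G : WGraph k) (x : Fin k) where

  record ThreadPath (N : ℕ) (w : ℕ → Fin k) : Set where
    field
      edge        : ∀ {i} → i < N → Adjacent G (w i) (w (suc i))
      unweighted  : ∀ {i} → i < N → ω G (w i) (w (suc i)) ≡ 2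
      inner-not-x : ∀ {i} → i < N → 1 ≤ i → w i ≢ x
      inner-only  : ∀ {i} → i < N → 1 ≤ i → OnlyNeighbours G (w i) (w (i ∸ 1)) (w (suc i))
      ends-differ : w 0 ≢ w N

  module Simulation {N : ℕ} {w : ℕ → Fin k} (P : ThreadPath N w) where
    open ThreadPath P

    inner-ω : ∀ {c z} → c < N → 1 ≤ c → Adjacent G (w c) z → ω G (w c) z ≡ 2
    inner-ω {suc c} {z} c<N 1≤c cz with inner-only c<N 1≤c z cz
    ... | inj₁ refl = trans (ω-sym G (w (suc c)) (w c)) (unweighted (<-trans (n<1+n c) c<N))
    ... | inj₂ refl = unweighted c<N

    -- s′ is at most s with one pebble moved from each of w a, w b onto w c, w d; these two
    -- tokens sit on inner vertices of the thread, so s′ can only move them along it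
    record Lag (a c d b : ℕ) (s s′ : Distribution G) : Set where
      constructor lag
      field bound : ∀ v → s′ v + (δ (w a) v + δ (w b) v) ≤ s v + (δ (w c) v + δ (w d) v)

    data Covers (s s′ : Distribution G) : Set where
      dominates : (∀ v → s′ v ≤ s v) → Covers s s′
      lags      : ∀ {a c d b} → a < c → c < b → a < d → d < b → b ≤ N → Lag a c d b s s′ → Covers s s′

    CostTwo : Distribution G → ℕ → Fin k → Set
    CostTwo s′ c z = ∀ v → move G s′ (w c) z v + δ (w c) v + δ (w c) v ≡ s′ v + δ z v

    inner-move-cost-2 : ∀ {s′ : Distribution G} {c z} → c < N → 1 ≤ c → Adjacent G (w c) z →
                       ω G (w c) z ≤ s′ (w c) → CostTwo s′ c z
    inner-move-cost-2 {s′} {c} c<N 1≤c cz ω≤ = move-cost-2 G ω≡2 (subst (_≤ s′ (w c)) ω≡2 ω≤)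
      where ω≡2 = inner-ω c<N 1≤c cz

    lag-swapᵃ : ∀ {a c d b s s′} → Lag a c d b s s′ → Lag b c d a s s′
    lag-swapᵃ {a} {c} {d} {b} {s} {s′} (lag H) =
      lag λ v → subst (λ e → s′ v + e ≤ s v + (δ (w c) v + δ (w d) v)) (+-comm (δ (w a) v) (δ (w b) v)) (H v)

    lag-swapᵗ : ∀ {a c d b s s′} → Lag a c d b s s′ → Lag a d c b s s′
    lag-swapᵗ {a} {c} {d} {b} {s} {s′} (lag H) =
      lag λ v → subst (λ e → s′ v + (δ (w a) v + δ (w b) v) ≤ s v + e) (+-comm (δ (w c) v) (δ (w d) v)) (H v)

    lag-advances : ∀ {a c d b s s′ c′} → Lag a c d b s s′ → CostTwo s′ c (w c′) →
                   Lag a c′ d b s (move G s′ (w c) (w c′))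
    lag-advances {c = c} {s = s} {s′} {c′} (lag H) exact =
      lag λ v → token-advances (move G s′ (w c) (w c′) v) (s′ v) (s v) (exact v) (H v)

    lag-absorbed : ∀ {a c d b s s′} → Lag a c d b s s′ → CostTwo s′ c (w a) →
                   Lag c d d b s (move G s′ (w c) (w a))
    lag-absorbed {a} {c} {s = s} {s′} (lag H) exact =
      lag λ v → token-absorbed (move G s′ (w c) (w a) v) (s′ v) (s v) (exact v) (H v)

    lag-merged : ∀ {a c b s s′} → Lag a c c b s s′ → CostTwo s′ c (w a) → ∀ v → move G s′ (w c) (w a) v ≤ s v
    lag-merged {a} {c} {s = s} {s′} (lag H) exact v =
      tokens-absorbed (move G s′ (w c) (w a) v) (s′ v) (s v) (exact v) (H v)

    token-moves-along : ∀ {s s′ : Distribution G} {a c d b z} → a < c → c < b → a < d → d < b → b ≤ N →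
                        Lag a c d b s s′ → z ≡ w (c ∸ 1) ⊎ z ≡ w (suc c) → CostTwo s′ c z →
                        Covers s (move G s′ (w c) z)
    token-moves-along {a = a} {suc c} a<c c<b a<d d<b b≤N H (inj₁ refl) exact with m≤n⇒m<n∨m≡n (s≤s⁻¹ a<c)
    ... | inj₁ a<c′ = lags a<c′ (<-trans (n<1+n c) c<b) a<d d<b b≤N (lag-advances H exact)
    ... | inj₂ refl with m≤n⇒m<n∨m≡n a<d
    ...   | inj₁ c<d  = lags c<d d<b c<d d<b b≤N (lag-absorbed H exact)
    ...   | inj₂ refl = dominates (lag-merged H exact)
    token-moves-along {c = suc c} a<c c<b a<d d<b b≤N H (inj₂ refl) exact with m≤n⇒m<n∨m≡n c<b
    ... | inj₁ c′<b = lags (<-trans a<c (n<1+n _)) c′<b a<d d<b b≤N (lag-advances H exact)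
    ... | inj₂ refl with m≤n⇒m<n∨m≡n (s≤s⁻¹ d<b)
    ...   | inj₁ d<c  =
      lags a<d d<c a<d d<c (≤-trans (n≤1+n _) b≤N) (lag-swapᵃ (lag-absorbed (lag-swapᵃ H) exact))
    ...   | inj₂ refl = dominates (lag-merged (lag-swapᵃ H) exact)

    token-moves : ∀ {s s′ : Distribution G} {a c d b z} → a < c → c < b → a < d → d < b → b ≤ N →
                  Lag a c d b s s′ → Adjacent G (w c) z → ω G (w c) z ≤ s′ (w c) →
                  Covers s (move G s′ (w c) z)
    token-moves {z = z} a<c c<b a<d d<b b≤N H cz ω≤ =
      token-moves-along a<c c<b a<d d<b b≤N H (inner-only c<N 1≤c z cz) (inner-move-cost-2 c<N 1≤c cz ω≤)
      where
      c<N = <-≤-trans c<b b≤N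
      1≤c = ≤-trans (s≤s z≤n) a<c

    covers-step : ∀ {s s′ : Distribution G} {y z} → Covers s s′ → Adjacent G y z → ω G y z ≤ s′ y →
                  ∃ λ t → Executes G s t × Covers t (move G s′ y z)
    covers-step {s} {s′} {y} {z} (dominates s′≤s) yz ω≤ =
      move G s y z , step y z yz ω≤sy done ,
      dominates (λ v → ≤-without-offset (move-mono G ω≤ ω≤sy (λ v → +-monoˡ-≤ 0 (s′≤s v)) v) refl)
      where ω≤sy = ≤-trans ω≤ (s′≤s y)
    covers-step {s} {s′} {y} {z} (lags {a} {c} {d} {b} a<c c<b a<d d<b b≤N H) yz ω≤ with y ≟ w c | y ≟ w d
    ... | yes refl | _        = s , done , token-moves a<c c<b a<d d<b b≤N H yz ω≤
    ... | no _     | yes refl = s , done , token-moves a<d d<b a<c c<b b≤N (lag-swapᵗ H) yz ω≤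
    ... | no y≢c   | no y≢d   =
      move G s y z , step y z yz ω≤sy done ,
      lags a<c c<b a<d d<b b≤N (lag (move-mono G ω≤ ω≤sy (Lag.bound H)))
      where ω≤sy = ≤-trans ω≤ (≤-without-offset (Lag.bound H y) (cong₂ _+_ (δ-≢ y≢c) (δ-≢ y≢d)))

    covers-executes : ∀ {s s′ q′ : Distribution G} → Covers s s′ → Executes G s′ q′ →
                      ∃ λ q → Executes G s q × Covers q q′
    covers-executes cov done = _ , done , cov
    covers-executes cov (step y z yz ω≤ rest) with covers-step cov yz ω≤
    ... | t , s→t , cov′ with covers-executes cov′ rest
    ...   | q , t→q , cov″ = q , executes-trans G s→t t→q , cov″

    covers-goal : ∀ {q q′ : Distribution G} → Covers q q′ → 1 ≤ q′ x → 1 ≤ q x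
    covers-goal (dominates q′≤q) 1≤q′x = ≤-trans 1≤q′x (q′≤q x)
    covers-goal (lags {_} {c} {d} {b} a<c c<b a<d d<b b≤N H) 1≤q′x =
      ≤-trans 1≤q′x
        (≤-without-offset (Lag.bound H x) (cong₂ _+_ (δ-≢ (x≢inner a<c c<b)) (δ-≢ (x≢inner a<d d<b))))
      where
      x≢inner : ∀ {a e} → a < e → e < b → x ≢ w e
      x≢inner a<e e<b x≡we = inner-not-x (<-≤-trans e<b b≤N) (≤-trans (s≤s z≤n) a<e) (sym x≡we)

    covers-unreachable : ∀ {q q′ : Distribution G} → Covers q q′ → ¬ Reachable G x q → ¬ Reachable G x q′
    covers-unreachable cov ¬reach (r , q′→r , 1≤rx) with covers-executes cov q′→r
    ... | t , q→t , cov′ = ¬reach (t , q→t , covers-goal cov′ 1≤rx)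

    squish : Distribution G → Distribution G
    squish q = relocate (relocate q (w 0) (w 1)) (w N) (w (N ∸ 1))

    module _ {q : Distribution G} (start : 1 ≤ q (w 0)) (end : 1 ≤ q (w N)) where

      end-after-first : 1 ≤ relocate q (w 0) (w 1) (w N)
      end-after-first = ≤-trans end (subst (λ e → q (w N) ≤ q (w N) ∸ e + δ (w 1) (w N))
                                        (sym (δ-≢ (λ wN≡w0 → ends-differ (sym wN≡w0)))) (m≤m+n _ _))

      squish-+δ : ∀ v → squish q v + (δ (w 0) v + δ (w N) v) ≡ q v + (δ (w 1) v + δ (w (N ∸ 1)) v)
      squish-+δ v = begin
        squish q v + (δ (w 0) v + δ (w N) v)         ≡⟨ cong (squish q v +_) (+-comm (δ (w 0) v) _) ⟩
        squish q v + (δ (w N) v + δ (w 0) v)         ≡⟨ +-assoc (squish q v) _ _ ⟨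
        squish q v + δ (w N) v + δ (w 0) v           ≡⟨ cong (_+ δ (w 0) v) (relocate-+δ _ end-after-first v) ⟩
        first v + δ (w (N ∸ 1)) v + δ (w 0) v        ≡⟨ xy∙z≈xz∙y (first v) _ _ ⟩
        first v + δ (w 0) v + δ (w (N ∸ 1)) v        ≡⟨ cong (_+ δ (w (N ∸ 1)) v) (relocate-+δ _ start v) ⟩
        q v + δ (w 1) v + δ (w (N ∸ 1)) v            ≡⟨ +-assoc (q v) _ _ ⟩
        q v + (δ (w 1) v + δ (w (N ∸ 1)) v)          ∎
        where
        open ≡-Reasoning
        first = relocate q (w 0) (w 1)

      squish-covered : 2 ≤ N → Covers q (squish q)
      squish-covered 2≤N = lags (s≤s z≤n) 2≤N (m<n⇒0<n∸m 2≤N) (∸-monoʳ-< (s≤s z≤n) (<⇒≤ 2≤N)) ≤-refl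
                                (lag λ v → ≤-reflexive (squish-+δ v))

      ∑-squish : ∑ (squish q) ≡ ∑ q
      ∑-squish = trans (∑-relocate (w (N ∸ 1)) end-after-first) (∑-relocate (w 1) start)

      ·-squish : ∀ h → squish q · h + h (w 0) + h (w N) ≡ q · h + h (w 1) + h (w (N ∸ 1))
      ·-squish h = begin
        squish q · h + h (w 0) + h (w N)         ≡⟨ xy∙z≈xz∙y (squish q · h) _ _ ⟩
        squish q · h + h (w N) + h (w 0)         ≡⟨ cong (_+ h (w 0)) (·-relocate _ h end-after-first) ⟩
        first · h + h (w (N ∸ 1)) + h (w 0)      ≡⟨ xy∙z≈xz∙y (first · h) _ _ ⟩
        first · h + h (w 0) + h (w (N ∸ 1))      ≡⟨ cong (_+ h (w (N ∸ 1))) (·-relocate _ h start) ⟩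
        q · h + h (w 1) + h (w (N ∸ 1))          ∎
        where
        open ≡-Reasoning
        first = relocate q (w 0) (w 1)

  thread-path? : ∀ N w → Dec (ThreadPath N w)
  thread-path? N w = map′
    (λ (e , u , nx , only , ends) →
       record { edge = e ; unweighted = u ; inner-not-x = nx ; inner-only = only ; ends-differ = ends })
    (λ P → let open ThreadPath P in
       (λ {i} → edge {i}) , (λ {i} → unweighted {i}) , (λ {i} → inner-not-x {i}) , (λ {i} → inner-only {i}) ,
       ends-differ)
    (allUpTo? (λ i → adj G (w i) (w (suc i)) ≟ᵇ true) N
     ×-dec allUpTo? (λ i → ω G (w i) (w (suc i)) ≟ℕ 2) N
     ×-dec allUpTo? (λ i → (1 ≤? i) →-dec ¬? (w i ≟ x)) N
     ×-dec allUpTo? (λ i → (1 ≤? i) →-dec all? λ z →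
                             (adj G (w i) z ≟ᵇ true) →-dec (z ≟ w (i ∸ 1) ⊎-dec z ≟ w (suc i))) N
     ×-dec ¬? (w 0 ≟ w N))

  thread-path-cong : ∀ {N u v} → (∀ {i} → i ≤ N → u i ≡ v i) → ThreadPath N u → ThreadPath N v
  thread-path-cong {N} {u} {v} agree P = record
    { edge        = λ i<N → subst₂ (Adjacent G) (agree (<⇒≤ i<N)) (agree i<N) (edge i<N)
    ; unweighted  = λ i<N → subst₂ (λ p r → ω G p r ≡ 2) (agree (<⇒≤ i<N)) (agree i<N) (unweighted i<N)
    ; inner-not-x = λ i<N 1≤i → subst (_≢ x) (agree (<⇒≤ i<N)) (inner-not-x i<N 1≤i)
    ; inner-only  = λ {i} i<N 1≤i →
        only-cong (agree (<⇒≤ i<N)) (agree (≤-trans (m∸n≤m i 1) (<⇒≤ i<N))) (agree i<N) (inner-only i<N 1≤i)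
    ; ends-differ = subst₂ _≢_ (agree z≤n) (agree ≤-refl) ends-differ
    }
    where
    open ThreadPath P
    only-cong : ∀ {a b c a′ b′ c′} → a ≡ a′ → b ≡ b′ → c ≡ c′ →
                OnlyNeighbours G a b c → OnlyNeighbours G a′ b′ c′
    only-cong refl refl refl only = only

  Squishable : Distribution G → ℕ → (ℕ → Fin k) → Set
  Squishable q N w = 2 ≤ N × ThreadPath N w × 1 ≤ q (w 0) × 1 ≤ q (w N)

  squishable? : ∀ q → (∃ λ N → ∃ λ w → Squishable q N w) ⊎ (∀ {N} → N < 2 + k → ∀ w → ¬ Squishable q N w)
  squishable? q with anyUpTo? (λ N → decide-∃-sequence N (squishable-cong N) (squishable-dec N)) (2 + k)
    where
    squishable-dec : ∀ N w → Dec (Squishable q N w)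
    squishable-dec N w = (2 ≤? N) ×-dec thread-path? N w ×-dec (1 ≤? q (w 0)) ×-dec (1 ≤? q (w N))
    squishable-cong : ∀ N {u v} → (∀ {i} → i ≤ N → u i ≡ v i) → Squishable q N u → Squishable q N v
    squishable-cong N agree (2≤N , P , start , end) =
      2≤N , thread-path-cong agree P ,
      subst (λ a → 1 ≤ q a) (agree z≤n) start , subst (λ a → 1 ≤ q a) (agree ≤-refl) end
  ... | yes (N , _ , w , squishable) = inj₁ (N , w , squishable)
  ... | no none                     = inj₂ λ N<2+k w squishable → none (_ , N<2+k , w , squishable)

  module _ {n v} (ear : IsEar G x n v) (not-closed : ¬ IsClosedEar G n v) (unweighted : Unweighted G n v) where
    open IsEar ear

    ear-injective : ∀ {i j} → i < j → j ≤ suc n → v i ≢ v j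
    ear-injective {zero} {j} 0<j j≤1+n with m≤n⇒m<n∨m≡n j≤1+n
    ... | inj₁ j≤n  = proj₁ (ends-out j 0<j (s≤s⁻¹ j≤n))
    ... | inj₂ refl = not-closed
    ear-injective {suc i} {j} i<j j≤1+n with m≤n⇒m<n∨m≡n j≤1+n
    ... | inj₁ j≤n  = λ vi≡vj → <-irrefl (inner-inj (suc i) j (s≤s z≤n) (≤-trans (<⇒≤ i<j) (s≤s⁻¹ j≤n))
                                                           (≤-trans (s≤s z≤n) i<j) (s≤s⁻¹ j≤n) vi≡vj) i<j
    ... | inj₂ refl = λ vi≡vj → proj₂ (ends-out (suc i) (s≤s z≤n) (s≤s⁻¹ i<j)) (sym vi≡vj)

    ear-length≤k : n ≤ k
    ear-length≤k = injective⇒≤ {f = λ j → v (suc (toℕ j))}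
      (λ e → toℕ-injective (suc-injective (inner-inj _ _ (s≤s z≤n) (toℕ<n _) (s≤s z≤n) (toℕ<n _) e)))

    ear-segment : ∀ {i N} → 1 ≤ N → N + i ≤ suc n → ThreadPath N (λ t → v (t + i))
    ear-segment {i} {N} 1≤N N+i≤1+n = record
      { edge        = λ {t} t<N → consec-adj (t + i) (inside t<N)
      ; unweighted  = λ {t} t<N → unweighted (t + i) (inside t<N)
      ; inner-not-x = λ {t} t<N 1≤t → inner-notx (t + i) (≤-trans 1≤t (m≤m+n t i)) (inside t<N)
      ; inner-only  = only
      ; ends-differ = ear-injective (+-monoˡ-≤ i 1≤N) N+i≤1+n
      }
      where
      inside : ∀ {t} → t < N → t + i ≤ n
      inside t<N = s≤s⁻¹ (≤-trans (+-monoˡ-< i t<N) N+i≤1+n)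
      only : ∀ {t} → t < N → 1 ≤ t → OnlyNeighbours G (v (t + i)) (v (t ∸ 1 + i)) (v (suc t + i))
      only {suc t} t<N _ = deg≡2⇒only-neighbours G (inner-deg (suc t + i) (s≤s z≤n) (inside t<N))
        (adjacent-sym G (consec-adj (t + i) (≤-trans (n≤1+n _) (inside t<N))))
        (consec-adj (suc t + i) (inside t<N)) (inner-nbrs (suc t + i) (s≤s z≤n) (inside t<N))

  -- cut ears need no special treatment: the argument works for every unweighted ear that is not closed
  no-squishable⇒squished : ∀ q → (∀ {N} → N < 2 + k → ∀ w → ¬ Squishable q N w) →
                           ∀ n v → IsOpenEar G x n v → Unweighted G n v → Squished G q n v
  no-squishable⇒squished q none n v (ear , not-closed , _) unweighted
    with squished-indices (λ j → 1 ≤? q (v j)) n gap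
    where
    gap : ∀ {i N} → 2 ≤ N → N + i ≤ suc n → 1 ≤ q (v i) → 1 ≤ q (v (N + i)) → ⊥
    gap {i} {N} 2≤N N+i≤1+n start end =
      none (s≤s (≤-trans (m≤m+n N i) (≤-trans N+i≤1+n (s≤s (ear-length≤k ear not-closed unweighted)))))
           (λ t → v (t + i)) (2≤N , ear-segment ear not-closed unweighted (<⇒≤ 2≤N) N+i≤1+n , start , end)
  ... | i , i≤n , empty = i , i≤n , λ j j≤1+n j≢i j≢1+i → n<1⇒n≡0 (≰⇒> (empty j j≤1+n j≢i j≢1+i))

module Potential {k : ℕ} (G : WGraph k) (x : Fin k) (connected : Connected G) where

  Near : ℕ → Fin k → Set
  Near zero    u = u ≡ x
  Near (suc t) u = Near t u ⊎ ∃ λ z → Adjacent G u z × Near t z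

  near? : ∀ t u → Dec (Near t u)
  near? zero    u = u ≟ x
  near? (suc t) u = near? t u ⊎-dec any? (λ z → (adj G u z ≟ᵇ true) ×-dec near? t z)

  walk-length : ∀ {ok u v} → WalkIn G ok u v → ℕ
  walk-length (here _)      = 0
  walk-length (there _ _ W) = suc (walk-length W)

  walk-near : ∀ {ok u} (W : WalkIn G ok u x) → Near (walk-length W) u
  walk-near (here _)             = refl
  walk-near (there {v = v} _ uv W) = inj₂ (v , uv , walk-near W)

  distance : ∀ u → ∃ λ i → Near i u × (∀ {j} → j < i → ¬ Near j u)
  distance u = least (λ t → near? t u) (walk-near (connected u x))

  dist : Fin k → ℕ
  dist u = proj₁ (distance u)

  dist-≤ : ∀ {t u} → Near t u → dist u ≤ t
  dist-≤ {u = u} = minimal-≤ (proj₂ (proj₂ (distance u)))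

  dist-adjacent : ∀ {u z} → Adjacent G u z → dist u ≤ suc (dist z)
  dist-adjacent {z = z} uz = dist-≤ (inj₂ (z , uz , proj₁ (proj₂ (distance z))))

  dist-descent : ∀ {u} → u ≢ x → ∃ λ z → Adjacent G u z × dist z < dist u
  dist-descent {u} = descent (proj₁ (proj₂ (distance u))) (proj₂ (proj₂ (distance u)))
    where
    descent : ∀ {i} → Near i u → (∀ {j} → j < i → ¬ Near j u) → u ≢ x → ∃ λ z → Adjacent G u z × dist z < i
    descent {zero}  u≡x                 _     u≢x = ⊥-elim (u≢x u≡x)
    descent {suc t} (inj₁ near)         below _   = ⊥-elim (below ≤-refl near)
    descent {suc t} (inj₂ (z , uz , near)) _  _   = z , uz , s≤s (dist-≤ near)

  bound : ℕ
  bound = ∑ (λ u → walk-length (connected u x))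

  dist≤bound : ∀ u → dist u ≤ bound
  dist≤bound u = ≤-trans (dist-≤ (walk-near (connected u x))) (≤∑ (λ u → walk-length (connected u x)) u)

  φ : Fin k → ℕ
  φ u = (bound ∸ dist u) * (bound ∸ dist u)

  Φ : Distribution G → ℕ
  Φ q = q · φ

  φ-towards : ∀ {u l o} → dist l < dist u → Adjacent G u o → φ u + φ u + 1 ≤ φ l + φ o
  φ-towards {u} {l} {o} l<u uo = square-convex (∸-monoʳ-< l<u (dist≤bound u)) (begin
    bound ∸ dist u              ≤⟨ ∸≤suc∸suc bound (dist u) ⟩
    suc (bound ∸ suc (dist u))  ≤⟨ s≤s (∸-monoʳ-≤ bound (dist-adjacent (adjacent-sym G uo))) ⟩
    suc (bound ∸ dist o)        ∎)
    where open ≤-Reasoning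

  φ-convex : ∀ {u p r} → u ≢ x → Adjacent G u p → Adjacent G u r → OnlyNeighbours G u p r →
             φ u + φ u + 1 ≤ φ p + φ r
  φ-convex {u} {p} {r} u≢x up ur only with dist-descent u≢x
  ... | z , uz , z<u with only z uz
  ...   | inj₁ refl = φ-towards {l = p} z<u ur
  ...   | inj₂ refl = subst (φ u + φ u + 1 ≤_) (+-comm (φ r) (φ p)) (φ-towards {l = r} z<u up)

  squish-decreases : ∀ {N w} {q : Distribution G} (P : ThreadPath G x N w) → 2 ≤ N →
                     (start : 1 ≤ q (w 0)) (end : 1 ≤ q (w N)) → Φ (Simulation.squish G x P q) < Φ q
  squish-decreases {suc (suc g)} {w} P (s≤s (s≤s z≤n)) start end =
    <-from-balance (Simulation.·-squish G x P start end φ) (convex-telescope (λ i → φ (w i)) g convex)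
    where
    open ThreadPath P
    convex : ∀ {i} → i < 2 + g → 1 ≤ i → φ (w i) + φ (w i) + 1 ≤ φ (w (i ∸ 1)) + φ (w (suc i))
    convex {suc i} i<N 1≤i = φ-convex (inner-not-x i<N 1≤i) (adjacent-sym G (edge (<-trans (n<1+n i) i<N)))
                                      (edge i<N) (inner-only i<N 1≤i)

  squish-step : ∀ {q N w} → Squishable G x q N w →
                ∃ λ q′ → Φ q′ < Φ q × ∑ q′ ≡ ∑ q × (¬ Reachable G x q → ¬ Reachable G x q′)
  squish-step {q} (2≤N , P , start , end) =
    squish q , squish-decreases P 2≤N start end , ∑-squish start end ,
    covers-unreachable (squish-covered start end 2≤N)
    where open Simulation G x P

  squish-all : ∀ q → Acc _<_ (Φ q) → ¬ Reachable G x q →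
               ∃ λ q′ → ∑ q′ ≡ ∑ q × (∀ n v → IsOpenEar G x n v → Unweighted G n v → Squished G q′ n v) ×
                        ¬ Reachable G x q′
  squish-all q (acc smaller) ¬reach with squishable? G x q
  ... | inj₂ none = q , refl , no-squishable⇒squished G x q none , ¬reach
  ... | inj₁ (_ , _ , squishable) with squish-step squishable
  ...   | q₁ , Φq₁<Φq , ∑q₁≡∑q , unreachable₁ with squish-all q₁ (smaller Φq₁<Φq) (unreachable₁ ¬reach)
  ...     | q′ , ∑q′≡∑q₁ , squished , ¬reach′ = q′ , trans ∑q′≡∑q₁ ∑q₁≡∑q , squished , ¬reach′

lemma9p1 : (k : ℕ) (G : WGraph k) → Connected G → (x : Fin k) →
    (p : Distribution G) → ¬ Reachable G x p →
    Σ (Distribution G) λ q → size G q ≡ size G p ×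
      (∀ n v → IsOpenEar G x n v → Unweighted G n v → Squished G q n v) ×
      ¬ Reachable G x q
lemma9p1 k G connected x p ¬reach with Potential.squish-all G x connected p (<-wellFounded _) ¬reach
... | q , ∑q≡∑p , squished , ¬reach′ =
  q , trans (∑-allFin q) (trans ∑q≡∑p (sym (∑-allFin p))) , squished , ¬reach′
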